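{- Let $p,q$ be primes with $2<p<q$. Then $g_0$ is representable if and only if $\kappa+\lambda<p$.
   Context: Let $p,q$ be primes with $2<p<q$, and put $p'=(p-1)/2$, $q'=(q-1)/2$. Set $d_0=pq$, $d_1=p'q$, $d_2=pq'$, $d_3=(pq-1)/2$, and for integers $x,y,z,w$ put $f(x,y,z,w)=xd_0+yd_1+zd_2+wd_3$. An integer is representable if it equals $f(x,y,z,w)$ for some nonnegative integers $x,y,z,w$. Define $\kappa,\lambda$ by $q=\kappa p+\lambda$ with $1\le\lambda\le p-1$, and put $g_0=f(p'-1,p-1,\kappa,-1)$. -}

module Defs where

open import Data.Nat as ℕ using (ℕ)
open import Data.Nat.DivMod using (_/_)
open import Data.Integer as ℤ using (ℤ; +_; _+_; _*_; _-_)
open import Data.Product using (∃-syntax)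
open import Relation.Binary.PropositionalEquality using (_≡_)

-- p' = (p-1)/2 (floor division; exact for odd p)
half-pred : ℕ → ℕ
half-pred n = (n ℕ.∸ 1) / 2

d₀ d₁ d₂ d₃ : ℕ → ℕ → ℕ
d₀ p q = p ℕ.* q
d₁ p q = half-pred p ℕ.* q
d₂ p q = p ℕ.* half-pred q
d₃ p q = half-pred (p ℕ.* q)

f : ℕ → ℕ → ℤ → ℤ → ℤ → ℤ → ℤ
f p q x y z w =
  x * + d₀ p q + y * + d₁ p q + z * + d₂ p q + w * + d₃ p q

Representable : ℕ → ℕ → ℤ → Set
Representable p q n =
  ∃[ x ] ∃[ y ] ∃[ z ] ∃[ w ] n ≡ f p q (+ x) (+ y) (+ z) (+ w)

g₀ : ℕ → ℕ → ℕ → ℤ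
g₀ p q κ = f p q (+ half-pred p - + 1) (+ p - + 1) (+ κ) (ℤ.- + 1)

-- With p, q and pq odd, 2 f(x,y,z,w) = (2x+y+z+w) pq − (yq + zp + w), and with q = κp + l
-- the equation g₀ = f(x,y,z,w) becomes  M pq = yq + zp + w + l + 1,  where
-- M = 2x + y + z + w + 6 − 2p − κ.  If κ + l < p then p − κ − l is even (q is odd) and
-- M = 1, y = p − 2, z = 2κ, w = l − 1 is a solution.  Conversely M > 0, and reading the
-- equation modulo q and then modulo p gives positive c = Mp − y and t with
-- tp = w + 1 + (c − 1)(p − l); substituting back yields
-- 2x + (M + t − 2)(p − 1) + (c − 1)(κ + l − p) + 2 = 0, impossible when κ + l ≥ p.
module Submission where

open import Defs
open import Algebra.Bundles using (AbelianGroup)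
open import Data.Nat using (ℕ; zero; suc; _+_; _*_; _∸_; _<_; _≤_; _<?_; z≤n; s≤s; z<s)
open import Data.Nat.Properties
open import Data.Nat.DivMod using (_/_; m*n/n≡m)
open import Data.Nat.Primality using (Prime; prime⇒irreducible)
open import Data.Nat.Divisibility using (divides)
import Data.Nat.Tactic.RingSolver as ℕ-Solver
open import Data.Integer using (+_; 0ℤ; 1ℤ)
import Data.Integer as ℤ
import Data.Integer.Properties as ℤᵖ
import Data.Integer.Tactic.RingSolver as ℤ-Solver
open import Data.List using (_∷_; [])
open import Data.Product using (∃-syntax; _×_; _,_)
open import Data.Sum using (_⊎_; inj₁; inj₂)
open import Data.Empty using (⊥; ⊥-elim)
open import Relation.Nullary using (yes; no)
open import Relation.Binary.PropositionalEquality
open import Function.Bundles using (_⇔_; mk⇔; Equivalence)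
import Function.Properties.Equivalence as ⇔

open import Algebra.Properties.Group (AbelianGroup.group ℤᵖ.+-0-abelianGroup)
  using (∙-cancelʳ)

open ≡-Reasoning

Odd : ℕ → Set
Odd n = suc (2 * half-pred n) ≡ n

even-or-odd : ∀ n → ∃[ k ] (n ≡ 2 * k ⊎ n ≡ suc (2 * k))
even-or-odd zero = 0 , inj₁ refl
even-or-odd (suc n) with even-or-odd n
... | k , inj₁ n≡2k   = k , inj₂ (cong suc n≡2k)
... | k , inj₂ n≡1+2k = suc k , inj₁ (cong suc (trans n≡1+2k (sym (+-suc k (k + 0)))))

Odd-1+2* : ∀ k → Odd (suc (2 * k))
Odd-1+2* k = cong (λ j → suc (2 * j)) (trans (cong (_/ 2) (*-comm 2 k)) (m*n/n≡m k 2))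

Prime⇒Odd : ∀ {p} → Prime p → 2 < p → Odd p
Prime⇒Odd {p} p-prime 2<p with even-or-odd p
... | k , inj₂ p≡1+2k = subst Odd (sym p≡1+2k) (Odd-1+2* k)
... | k , inj₁ p≡2k with prime⇒irreducible p-prime (divides k (trans p≡2k (*-comm 2 k)))
...   | inj₂ 2≡p = ⊥-elim (<-irrefl 2≡p 2<p)

Odd-* : ∀ {m n} → Odd m → Odd n → Odd (m * n)
Odd-* {m} {n} odd-m odd-n =
  subst Odd (trans (odd-product a b) (cong₂ _*_ odd-m odd-n)) (Odd-1+2* (a + b + 2 * a * b))
  where
  a b : ℕ
  a = half-pred m
  b = half-pred n
  odd-product : ∀ a b → suc (2 * (a + b + 2 * a * b)) ≡ suc (2 * a) * suc (2 * b)
  odd-product = ℕ-Solver.solve-∀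

fℕ : ℕ → ℕ → ℕ → ℕ → ℕ → ℕ → ℕ
fℕ p q x y z w = x * d₀ p q + y * d₁ p q + z * d₂ p q + w * d₃ p q

f-pos : ∀ p q x y z w → f p q (+ x) (+ y) (+ z) (+ w) ≡ + fℕ p q x y z w
f-pos p q x y z w = sym (begin
  + (a + b + c + e)          ≡⟨ ℤᵖ.pos-+ (a + b + c) e ⟩
  + (a + b + c) ℤ.+ + e      ≡⟨ cong (ℤ._+ + e) (ℤᵖ.pos-+ (a + b) c) ⟩
  + (a + b) ℤ.+ + c ℤ.+ + e  ≡⟨ cong (λ i → i ℤ.+ + c ℤ.+ + e) (ℤᵖ.pos-+ a b) ⟩
  + a ℤ.+ + b ℤ.+ + c ℤ.+ + e
    ≡⟨ cong₂ ℤ._+_ (cong₂ ℤ._+_ (cong₂ ℤ._+_ (ℤᵖ.pos-* x _) (ℤᵖ.pos-* y _)) (ℤᵖ.pos-* z _))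
                   (ℤᵖ.pos-* w _) ⟩
  f p q (+ x) (+ y) (+ z) (+ w) ∎)
  where
  a b c e : ℕ
  a = x * d₀ p q
  b = y * d₁ p q
  c = z * d₂ p q
  e = w * d₃ p q

-- g₀ + d₀ + d₁ + d₃ and f(x,y,z,w) + d₀ + d₁ + d₃,
-- the shift that clears the negative coefficients of g₀.
shifted-g₀ : ℕ → ℕ → ℕ → ℕ
shifted-g₀ p q κ = fℕ p q (half-pred p) p κ 0

shifted-f : ℕ → ℕ → ℕ → ℕ → ℕ → ℕ → ℕ
shifted-f p q x y z w = fℕ p q (suc x) (suc y) z (suc w)

g₀+f[1,1,0,1] : ∀ p q κ →
  g₀ p q κ ℤ.+ f p q 1ℤ 1ℤ 0ℤ 1ℤ ≡ f p q (+ half-pred p) (+ p) (+ κ) 0ℤ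
g₀+f[1,1,0,1] p q κ =
  identity (+ half-pred p) (+ p) (+ κ) (+ d₀ p q) (+ d₁ p q) (+ d₂ p q) (+ d₃ p q)
  where
  open ℤ using () renaming (_+_ to _⊕_; _*_ to _⊛_; _-_ to _⊖_; -_ to ⊝_)
  identity : ∀ a b c D₀ D₁ D₂ D₃ →
    (a ⊖ + 1) ⊛ D₀ ⊕ (b ⊖ + 1) ⊛ D₁ ⊕ c ⊛ D₂ ⊕ (⊝ + 1) ⊛ D₃
      ⊕ (1ℤ ⊛ D₀ ⊕ 1ℤ ⊛ D₁ ⊕ 0ℤ ⊛ D₂ ⊕ 1ℤ ⊛ D₃)
      ≡ a ⊛ D₀ ⊕ b ⊛ D₁ ⊕ c ⊛ D₂ ⊕ 0ℤ ⊛ D₃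
  identity = ℤ-Solver.solve-∀

f+f[1,1,0,1] : ∀ p q x y z w →
  f p q x y z w ℤ.+ f p q 1ℤ 1ℤ 0ℤ 1ℤ ≡ f p q (1ℤ ℤ.+ x) (1ℤ ℤ.+ y) z (1ℤ ℤ.+ w)
f+f[1,1,0,1] p q x y z w = identity x y z w (+ d₀ p q) (+ d₁ p q) (+ d₂ p q) (+ d₃ p q)
  where
  open ℤ using () renaming (_+_ to _⊕_; _*_ to _⊛_)
  identity : ∀ x y z w D₀ D₁ D₂ D₃ →
    x ⊛ D₀ ⊕ y ⊛ D₁ ⊕ z ⊛ D₂ ⊕ w ⊛ D₃ ⊕ (1ℤ ⊛ D₀ ⊕ 1ℤ ⊛ D₁ ⊕ 0ℤ ⊛ D₂ ⊕ 1ℤ ⊛ D₃)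
      ≡ (1ℤ ⊕ x) ⊛ D₀ ⊕ (1ℤ ⊕ y) ⊛ D₁ ⊕ z ⊛ D₂ ⊕ (1ℤ ⊕ w) ⊛ D₃
  identity = ℤ-Solver.solve-∀

g₀≡f⇔shifted : ∀ p q κ x y z w →
  (g₀ p q κ ≡ f p q (+ x) (+ y) (+ z) (+ w))
    ⇔ (shifted-g₀ p q κ ≡ shifted-f p q x y z w)
g₀≡f⇔shifted p q κ x y z w = mk⇔
  (λ g₀≡f → ℤᵖ.+-injective (begin
    + shifted-g₀ p q κ                        ≡⟨ f-pos p q (half-pred p) p κ 0 ⟨
    f p q (+ half-pred p) (+ p) (+ κ) 0ℤ      ≡⟨ g₀+f[1,1,0,1] p q κ ⟨
    g₀ p q κ ℤ.+ f₁                           ≡⟨ cong (ℤ._+ f₁) g₀≡f ⟩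
    f p q (+ x) (+ y) (+ z) (+ w) ℤ.+ f₁      ≡⟨ f+f[1,1,0,1] p q (+ x) (+ y) (+ z) (+ w) ⟩
    f p q (+ suc x) (+ suc y) (+ z) (+ suc w) ≡⟨ f-pos p q (suc x) (suc y) z (suc w) ⟩
    + shifted-f p q x y z w                   ∎))
  (λ g₀′≡f′ → ∙-cancelʳ f₁ _ _ (begin
    g₀ p q κ ℤ.+ f₁                           ≡⟨ g₀+f[1,1,0,1] p q κ ⟩
    f p q (+ half-pred p) (+ p) (+ κ) 0ℤ      ≡⟨ f-pos p q (half-pred p) p κ 0 ⟩
    + shifted-g₀ p q κ                        ≡⟨ cong +_ g₀′≡f′ ⟩
    + shifted-f p q x y z w                   ≡⟨ f-pos p q (suc x) (suc y) z (suc w) ⟨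
    f p q (+ suc x) (+ suc y) (+ z) (+ suc w) ≡⟨ f+f[1,1,0,1] p q (+ x) (+ y) (+ z) (+ w) ⟨
    f p q (+ x) (+ y) (+ z) (+ w) ℤ.+ f₁      ∎))
  where
  f₁ : ℤ.ℤ
  f₁ = f p q 1ℤ 1ℤ 0ℤ 1ℤ

twice-fℕ : ∀ {p q} → Odd p → Odd q → Odd (p * q) → ∀ x y z w →
  2 * fℕ p q x y z w + (y * q + z * p + w) ≡ (2 * x + y + z + w) * (p * q)
twice-fℕ {p} {q} odd-p odd-q odd-pq x y z w = begin
  2 * fℕ p q x y z w + (y * q + z * p + w)
    ≡⟨ regroup x y z w p q P Q R ⟩
  2 * x * (p * q) + y * (suc (2 * P) * q) + z * (p * suc (2 * Q)) + w * suc (2 * R)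
    ≡⟨ cong₂ (λ a b → 2 * x * (p * q) + y * (a * q) + z * (p * b) + w * suc (2 * R)) odd-p odd-q ⟩
  2 * x * (p * q) + y * (p * q) + z * (p * q) + w * suc (2 * R)
    ≡⟨ cong (λ c → 2 * x * (p * q) + y * (p * q) + z * (p * q) + w * c) odd-pq ⟩
  2 * x * (p * q) + y * (p * q) + z * (p * q) + w * (p * q)
    ≡⟨ collect x y z w (p * q) ⟩
  (2 * x + y + z + w) * (p * q) ∎
  where
  P Q R : ℕ
  P = half-pred p
  Q = half-pred q
  R = half-pred (p * q)
  regroup : ∀ x y z w p q P Q R →
    2 * (x * (p * q) + y * (P * q) + z * (p * Q) + w * R) + (y * q + z * p + w)
      ≡ 2 * x * (p * q) + y * (suc (2 * P) * q) + z * (p * suc (2 * Q)) + w * suc (2 * R)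
  regroup = ℕ-Solver.solve-∀
  collect : ∀ x y z w t → 2 * x * t + y * t + z * t + w * t ≡ (2 * x + y + z + w) * t
  collect = ℕ-Solver.solve-∀

-- The equation 2 g₀ = 2 f(x, y, z, w), cleared of subtractions by q = κp + l.
KeyEquation : (p q κ l x y z w : ℕ) → Set
KeyEquation p q κ l x y z w =
  (2 * x + y + z + w + 6) * (p * q) ≡ (2 * p + κ) * (p * q) + suc (y * q + z * p + w + l)

module _ {p q κ l : ℕ} (odd-p : Odd p) (odd-q : Odd q) (q≡κp+l : q ≡ κ * p + l) where

  private
    odd-pq : Odd (p * q)
    odd-pq = Odd-* odd-p odd-q

  twice-shifted-g₀ : ∀ n →
    2 * shifted-g₀ p q κ + (2 * (p * q) + q + suc n) ≡ (2 * p + κ) * (p * q) + suc (n + l)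
  twice-shifted-g₀ n = begin
    2 * G + (2 * (p * q) + q + suc n)
      ≡⟨ cong (λ r → 2 * G + (2 * (p * q) + r + suc n)) q≡κp+l ⟩
    2 * G + (2 * (p * q) + (κ * p + l) + suc n)
      ≡⟨ regroup G (p * q) p κ l n ⟩
    2 * G + (p * q + κ * p + 0) + (p * q + suc (n + l))
      ≡⟨ cong (_+ (p * q + suc (n + l))) (twice-fℕ odd-p odd-q odd-pq (half-pred p) p κ 0) ⟩
    (2 * half-pred p + p + κ + 0) * (p * q) + (p * q + suc (n + l))
      ≡⟨ collect (half-pred p) p κ (p * q) (suc (n + l)) ⟩
    (suc (2 * half-pred p) + p + κ) * (p * q) + suc (n + l)
      ≡⟨ cong (λ a → (a + p + κ) * (p * q) + suc (n + l)) odd-p ⟩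
    (p + p + κ) * (p * q) + suc (n + l)
      ≡⟨ cong (λ a → (p + a + κ) * (p * q) + suc (n + l)) (sym (+-identityʳ p)) ⟩
    (2 * p + κ) * (p * q) + suc (n + l) ∎
    where
    G : ℕ
    G = shifted-g₀ p q κ
    regroup : ∀ g t p κ l n →
      2 * g + (2 * t + (κ * p + l) + suc n) ≡ 2 * g + (t + κ * p + 0) + (t + suc (n + l))
    regroup = ℕ-Solver.solve-∀
    collect : ∀ P p κ t m → (2 * P + p + κ + 0) * t + (t + m) ≡ (suc (2 * P) + p + κ) * t + m
    collect = ℕ-Solver.solve-∀

  twice-shifted-f : ∀ x y z w →
    2 * shifted-f p q x y z w + (2 * (p * q) + q + suc (y * q + z * p + w))
      ≡ (2 * x + y + z + w + 6) * (p * q)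
  twice-shifted-f x y z w = begin
    2 * H + (2 * (p * q) + q + suc (y * q + z * p + w))
      ≡⟨ regroup H (p * q) y z w p q ⟩
    2 * H + (suc y * q + z * p + suc w) + 2 * (p * q)
      ≡⟨ cong (_+ 2 * (p * q)) (twice-fℕ odd-p odd-q odd-pq (suc x) (suc y) z (suc w)) ⟩
    (2 * suc x + suc y + z + suc w) * (p * q) + 2 * (p * q)
      ≡⟨ collect x y z w (p * q) ⟩
    (2 * x + y + z + w + 6) * (p * q) ∎
    where
    H : ℕ
    H = shifted-f p q x y z w
    regroup : ∀ h t y z w p q →
      2 * h + (2 * t + q + suc (y * q + z * p + w)) ≡ 2 * h + (suc y * q + z * p + suc w) + 2 * t
    regroup = ℕ-Solver.solve-∀
    collect : ∀ x y z w t →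
      (2 * suc x + suc y + z + suc w) * t + 2 * t ≡ (2 * x + y + z + w + 6) * t
    collect = ℕ-Solver.solve-∀

  shifted≡⇔key : ∀ x y z w →
    (shifted-g₀ p q κ ≡ shifted-f p q x y z w) ⇔ KeyEquation p q κ l x y z w
  shifted≡⇔key x y z w = mk⇔
    (λ g₀′≡f′ → begin
      (2 * x + y + z + w + 6) * (p * q)  ≡⟨ twice-shifted-f x y z w ⟨
      2 * shifted-f p q x y z w + c      ≡⟨ cong (λ h → 2 * h + c) g₀′≡f′ ⟨
      2 * shifted-g₀ p q κ + c           ≡⟨ twice-shifted-g₀ n ⟩
      (2 * p + κ) * (p * q) + suc (n + l) ∎)
    (λ key → *-cancelˡ-≡ _ _ 2 (+-cancelʳ-≡ c _ _ (begin
      2 * shifted-g₀ p q κ + c           ≡⟨ twice-shifted-g₀ n ⟩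
      (2 * p + κ) * (p * q) + suc (n + l) ≡⟨ key ⟨
      (2 * x + y + z + w + 6) * (p * q)  ≡⟨ twice-shifted-f x y z w ⟨
      2 * shifted-f p q x y z w + c      ∎)))
    where
    n c : ℕ
    n = y * q + z * p + w
    c = 2 * (p * q) + q + suc n

  representable-g₀⇔key :
    Representable p q (g₀ p q κ) ⇔ (∃[ x ] ∃[ y ] ∃[ z ] ∃[ w ] KeyEquation p q κ l x y z w)
  representable-g₀⇔key = mk⇔
    (λ (x , y , z , w , rep) → x , y , z , w , Equivalence.to (equiv x y z w) rep)
    (λ (x , y , z , w , key) → x , y , z , w , Equivalence.from (equiv x y z w) key)
    where
    equiv : ∀ x y z w →
      (g₀ p q κ ≡ f p q (+ x) (+ y) (+ z) (+ w)) ⇔ KeyEquation p q κ l x y z w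
    equiv x y z w = ⇔.trans (g₀≡f⇔shifted p q κ x y z w) (shifted≡⇔key x y z w)

even-gap-impossible : ∀ κ l e P Q →
  suc (2 * P) ≡ suc (κ + l) + 2 * e → suc (2 * Q) ≡ κ * suc (2 * P) + l → ⊥
even-gap-impossible κ l e P Q p≡ q≡ = even≢odd (κ * P + P) (Q + e) (begin
  2 * (κ * P + P)                ≡⟨ ℕ-Solver.solve (κ ∷ P ∷ []) ⟩
  2 * (κ * P) + 2 * P            ≡⟨ cong (_+_ (2 * (κ * P))) (suc-injective p≡) ⟩
  2 * (κ * P) + (κ + l + 2 * e)  ≡⟨ ℕ-Solver.solve (κ ∷ P ∷ l ∷ e ∷ []) ⟩
  κ * suc (2 * P) + l + 2 * e    ≡⟨ cong (_+ 2 * e) q≡ ⟨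
  suc (2 * Q) + 2 * e            ≡⟨ ℕ-Solver.solve (Q ∷ e ∷ []) ⟩
  suc (2 * (Q + e))              ∎)

gap-even : ∀ {p q κ l} → Odd p → Odd q → q ≡ κ * p + l → κ + l < p →
  ∃[ e ] p ≡ κ + l + 2 + 2 * e
gap-even {p} {q} {κ} {l} odd-p odd-q q≡κp+l κ+l<p with m≤n⇒∃[o]m+o≡n κ+l<p
... | d , 1+κ+l+d≡p with even-or-odd d
...   | e , inj₂ refl = e , trans (sym 1+κ+l+d≡p) (ℕ-Solver.solve (κ ∷ l ∷ e ∷ []))
...   | e , inj₁ refl = ⊥-elim (even-gap-impossible κ l e (half-pred p) (half-pred q)
                          (trans odd-p (sym 1+κ+l+d≡p))
                          (trans odd-q (trans q≡κp+l (cong (λ a → κ * a + l) (sym odd-p)))))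

-- The solution has M = 1: y = p − 2, and pq = (p − 2) q + 2κp + 2l.
key-solution : ∀ {p q} κ l₀ e → p ≡ κ + suc l₀ + 2 + 2 * e → q ≡ κ * p + suc l₀ →
  KeyEquation p q κ (suc l₀) e (κ + suc l₀ + 2 * e) (2 * κ) l₀
key-solution κ l₀ e refl refl = ℕ-Solver.solve (κ ∷ l₀ ∷ e ∷ [])

gap⇒key : ∀ {p q κ l} → Odd p → Odd q → q ≡ κ * p + l → 0 < l → κ + l < p →
  ∃[ x ] ∃[ y ] ∃[ z ] ∃[ w ] KeyEquation p q κ l x y z w
gap⇒key {κ = κ} {l = suc l₀} odd-p odd-q q≡κp+l (s≤s z≤n) κ+l<p
  with gap-even {κ = κ} {l = suc l₀} odd-p odd-q q≡κp+l κ+l<p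
... | e , p≡ = e , _ , _ , _ , key-solution κ l₀ e p≡ q≡κp+l

excess : ∀ a b n {r} → a * n ≡ b * n + suc r → ∃[ m ] a ≡ b + suc m × suc m * n ≡ suc r
excess a b n {r} an≡bn+1+r
  with m≤n⇒∃[o]m+o≡n (*-cancelʳ-< n b a (subst (b * n <_) (sym an≡bn+1+r) (m<m+n (b * n) z<s)))
... | m , refl = m , sym (+-suc b m) , +-cancelˡ-≡ (b * n) _ _ (begin
  b * n + suc m * n   ≡⟨ *-distribʳ-+ n b (suc m) ⟨
  (b + suc m) * n     ≡⟨ cong (_* n) (+-suc b m) ⟩
  (suc b + m) * n     ≡⟨ an≡bn+1+r ⟩
  b * n + suc r       ∎)

eliminate-q : ∀ {p q} κ l s c z w → l + s ≡ p → q ≡ κ * p + l →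
  suc c * q ≡ suc (z * p + w + l) → (κ + c * κ + c) * p ≡ z * p + suc (w + c * s)
eliminate-q κ l s c z w refl refl cq≡ = +-cancelʳ-≡ l _ _ (begin
  (κ + c * κ + c) * (l + s) + l      ≡⟨ ℕ-Solver.solve (κ ∷ l ∷ s ∷ c ∷ []) ⟩
  suc c * (κ * (l + s) + l) + c * s  ≡⟨ cong (_+ c * s) cq≡ ⟩
  suc (z * (l + s) + w + l) + c * s  ≡⟨ ℕ-Solver.solve (z ∷ l ∷ s ∷ w ∷ c ∷ []) ⟩
  z * (l + s) + suc (w + c * s) + l  ∎)

-- Adding the four equations leaves 0 = 2 + 2x + (m + t)(p − 1) + c(κ − (p − l)).
four-equations-inconsistent : ∀ {p κ} x y z w m c t l₀ s u → suc l₀ + s ≡ p → s + u ≡ κ →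
  2 * x + y + z + w + 6 ≡ 2 * p + κ + suc m →
  suc m * p ≡ y + suc c →
  κ + c * κ + c ≡ z + suc t →
  suc t * p ≡ suc (w + c * s) → ⊥
four-equations-inconsistent x y z w m c t l₀ s u refl refl E₀ E₁ E₂ E₃ =
  m+1+n≢m _ (trans (sym (surplus x y z w m c t l₀ s u))
                   (cong₂ _+_ (cong₂ _+_ (cong₂ _+_ E₀ E₁) E₂) E₃))
  where
  surplus : ∀ x y z w m c t l₀ s u → let p = suc l₀ + s; κ = s + u in
    2 * x + y + z + w + 6 + suc m * p + (κ + c * κ + c) + suc t * p
      ≡ 2 * p + κ + suc m + (y + suc c) + (z + suc t) + suc (w + c * s)
        + suc (suc (2 * x + (m + t) * (l₀ + s) + c * u))
  surplus = ℕ-Solver.solve-∀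

offsets : ∀ {l p κ} → l ≤ p → p ≤ κ + l → ∃[ s ] ∃[ u ] l + s ≡ p × s + u ≡ κ
offsets {l} {p} {κ} l≤p p≤κ+l with m≤n⇒∃[o]m+o≡n l≤p
... | s , refl with m≤n⇒∃[o]m+o≡n (+-cancelˡ-≤ l s κ (≤-trans p≤κ+l (≤-reflexive (+-comm κ l))))
...   | u , s+u≡κ = s , u , refl , s+u≡κ

split-y : ∀ M p q y z w l → M * (p * q) ≡ suc (y * q + z * p + w + l) →
  M * p * q ≡ y * q + suc (z * p + w + l)
split-y M p q y z w l eq =
  trans (*-assoc M p q) (trans eq (ℕ-Solver.solve (y ∷ q ∷ z ∷ p ∷ w ∷ l ∷ [])))

key-impossible : ∀ {p q κ l} x y z w → q ≡ κ * p + l → 0 < l → l ≤ p → p ≤ κ + l →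
  KeyEquation p q κ l x y z w → ⊥
key-impossible {p} {q} {κ} {suc l₀} x y z w q≡κp+l (s≤s z≤n) l≤p p≤κ+l key
  with offsets l≤p p≤κ+l | excess (2 * x + y + z + w + 6) (2 * p + κ) (p * q) key
... | s , u , l+s≡p , s+u≡κ | m , E₀ , Mpq≡
  with excess (suc m * p) y q (split-y (suc m) p q y z w (suc l₀) Mpq≡)
...   | c , E₁ , cq≡
  with excess (κ + c * κ + c) z p (eliminate-q κ (suc l₀) s c z w l+s≡p q≡κp+l cq≡)
...     | t , E₂ , E₃ = four-equations-inconsistent x y z w m c t l₀ s u l+s≡p s+u≡κ E₀ E₁ E₂ E₃

key⇒gap : ∀ {p q κ l} x y z w → q ≡ κ * p + l → 0 < l → l ≤ p →
  KeyEquation p q κ l x y z w → κ + l < p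
key⇒gap {p} {κ = κ} {l} x y z w q≡κp+l 0<l l≤p key with κ + l <? p
... | yes κ+l<p = κ+l<p
... | no  κ+l≮p = ⊥-elim (key-impossible x y z w q≡κp+l 0<l l≤p (≮⇒≥ κ+l≮p) key)

proposition5p1 : (p q κ l : ℕ) → Prime p → Prime q → 2 < p → p < q →
    q ≡ κ * p + l → 1 ≤ l → l ≤ p ∸ 1 →
    (Representable p q (g₀ p q κ) ⇔ (κ + l < p))
proposition5p1 p q κ l p-prime q-prime 2<p p<q q≡κp+l 0<l l≤p∸1 =
  ⇔.trans (representable-g₀⇔key odd-p odd-q q≡κp+l)
    (mk⇔ (λ (x , y , z , w , key) → key⇒gap x y z w q≡κp+l 0<l l≤p key)
         (gap⇒key odd-p odd-q q≡κp+l 0<l))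
  where
  odd-p : Odd p
  odd-p = Prime⇒Odd p-prime 2<p
  odd-q : Odd q
  odd-q = Prime⇒Odd q-prime (<-trans 2<p p<q)
  l≤p : l ≤ p
  l≤p = ≤-trans l≤p∸1 (m∸n≤m p 1)
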